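{- Let $D$ be a forcibly unicyclic or a forcibly bicyclic graphic sequence, and let $G$ be any realization of $D$. If we delete from $G$ all edges that lie on cycles of $G$, then each component of the resulting graph is isomorphic to a star or a double-star.
   Context: All graphs are simple. A realization of a sequence $D=(d_1,\ldots,d_n)$ is a simple graph with vertices $v_1,\ldots,v_n$ with $\deg(v_i)=d_i$; $D$ is graphic if it has a realization. A graphic sequence is forcibly unicyclic (resp. forcibly bicyclic) if every realization of it is connected and has exactly $n$ (resp. $n+1$) edges. A star is a tree of diameter at most $2$; a double-star is a tree of diameter exactly $3$. -}

module Defs where

open import Data.Nat using (ℕ; zero; suc; _+_; _≤_; _<ᵇ_)
open import Data.Bool using (Bool; true; false; if_then_else_; _∧_)
open import Data.Fin using (Fin; toℕ)
open import Data.List using (List; []; _∷_; _++_; map; allFin; length; take)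
open import Data.Nat.ListAction using (sum)
open import Data.List.Relation.Unary.All using (All)
open import Data.List.Relation.Unary.Unique.Propositional using (Unique)
open import Data.Product using (Σ; ∃; _×_; _,_)
open import Data.Sum using (_⊎_)
open import Data.Unit using (⊤)
open import Relation.Nullary using (¬_)
open import Relation.Binary.PropositionalEquality using (_≡_)

-- A simple graph on the vertex set Fin n (vertex i plays the role of v_{i+1}).
record Graph (n : ℕ) : Set where
  field
    adj    : Fin n → Fin n → Bool
    sym    : ∀ i j → adj i j ≡ adj j i
    irrefl : ∀ i → adj i i ≡ false
open Graph public

Edge : ∀ {n} → Graph n → Fin n → Fin n → Set
Edge G i j = adj G i j ≡ true

degree : ∀ {n} → Graph n → Fin n → ℕ
degree {n} G i = sum (map (λ j → if adj G i j then 1 else 0) (allFin n))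

edgeCount : ∀ {n} → Graph n → ℕ
edgeCount {n} G =
  sum (map (λ i → sum (map (λ j → if (toℕ i <ᵇ toℕ j) ∧ adj G i j then 1 else 0)
                             (allFin n)))
           (allFin n))

Realizes : ∀ {n} → Graph n → (Fin n → ℕ) → Set
Realizes G D = ∀ i → degree G i ≡ D i

Graphic : ∀ {n} → (Fin n → ℕ) → Set
Graphic {n} D = Σ (Graph n) λ G → Realizes G D

data Walk {n : ℕ} (R : Fin n → Fin n → Set) : Fin n → Fin n → ℕ → Set where
  nil  : ∀ {u} → Walk R u u 0
  cons : ∀ {u w v k} → R u w → Walk R w v k → Walk R u v (suc k)

Reach : ∀ {n} → (Fin n → Fin n → Set) → Fin n → Fin n → Set
Reach R u v = ∃ λ k → Walk R u v k

Connected : ∀ {n} → Graph n → Set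
Connected G = ∀ u v → Reach (Edge G) u v

ForciblyUnicyclic : ∀ {n} → (Fin n → ℕ) → Set
ForciblyUnicyclic {n} D =
  Graphic D × (∀ (G : Graph n) → Realizes G D → Connected G × edgeCount G ≡ n)

ForciblyBicyclic : ∀ {n} → (Fin n → ℕ) → Set
ForciblyBicyclic {n} D =
  Graphic D × (∀ (G : Graph n) → Realizes G D → Connected G × edgeCount G ≡ suc n)

Chain : ∀ {n} → (Fin n → Fin n → Set) → List (Fin n) → Set
Chain R []           = ⊤
Chain R (x ∷ [])     = ⊤
Chain R (x ∷ y ∷ l)  = R x y × Chain R (y ∷ l)

closeUp : ∀ {n} → List (Fin n) → List (Fin n)
closeUp cs = cs ++ take 1 cs

Cycle : ∀ {n} → (Fin n → Fin n → Set) → List (Fin n) → Set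
Cycle R cs = (3 ≤ length cs) × Unique cs × Chain R (closeUp cs)

Consec : ∀ {n} → Fin n → Fin n → List (Fin n) → Set
Consec {n} u v l = Σ (List (Fin n)) λ as → Σ (List (Fin n)) λ bs → l ≡ as ++ (u ∷ v ∷ bs)

OnCycle : ∀ {n} → Graph n → Fin n → Fin n → Set
OnCycle {n} G u v =
  Σ (List (Fin n)) λ cs → Cycle (Edge G) cs ×
    (Consec u v (closeUp cs) ⊎ Consec v u (closeUp cs))

DeleteCycleEdges : ∀ {n} → Graph n → Fin n → Fin n → Set
DeleteCycleEdges G u v = Edge G u v × ¬ OnCycle G u v

-- The component of vertex c in the graph with adjacency R, viewed as the
-- subgraph induced on {u | Reach R c u} (it is connected by construction).
InComp : ∀ {n} → (Fin n → Fin n → Set) → Fin n → Fin n → Set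
InComp R c u = Reach R c u

-- the component of c is a tree: connected (automatic) and without cycles
CompIsTree : ∀ {n} → (Fin n → Fin n → Set) → Fin n → Set
CompIsTree {n} R c = ∀ (cs : List (Fin n)) → All (InComp R c) cs → ¬ Cycle R cs

-- distance between a and b is at most d (walks from a vertex of the component
-- stay inside the component, so these are walks in the induced subgraph)
DistLE : ∀ {n} → (Fin n → Fin n → Set) → Fin n → Fin n → ℕ → Set
DistLE R a b d = ∃ λ k → k ≤ d × Walk R a b k

CompIsStar : ∀ {n} → (Fin n → Fin n → Set) → Fin n → Set
CompIsStar R c =
  CompIsTree R c × (∀ a b → InComp R c a → InComp R c b → DistLE R a b 2)

CompIsDoubleStar : ∀ {n} → (Fin n → Fin n → Set) → Fin n → Set
CompIsDoubleStar {n} R c =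
  CompIsTree R c
  × (∀ a b → InComp R c a → InComp R c b → DistLE R a b 3)
  × (Σ (Fin n) λ a → Σ (Fin n) λ b →
       InComp R c a × InComp R c b × ¬ DistLE R a b 2)

-- Deleting the edges that lie on cycles leaves a forest, so it suffices to show that no path of
-- cycle-free edges has four edges. Suppose a–b–c–d–e were one. Then bd and ae are not edges of G
-- (they would close cycles through bc and ab), so the 2-switch replacing ab, de by ae, bd yields
-- another realization of D. It is disconnected: the set of vertices reachable from b in G − ab − de
-- contains b and d but neither a nor e, because ab and de lie on no cycle, and the new edges ae, bd
-- do not leave it. This contradicts the fact that forcibly unicyclic and forcibly bicyclic
-- sequences are forcibly connected. Deciding whether two vertices are at distance at most 2 then
-- separates the stars from the double-stars.

module Submission where

open import Defs hiding (sym; irrefl)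
open import Data.Nat.Properties using (≤-pred; suc-injective; anyUpTo?; +-0-commutativeMonoid)
open import Algebra.Properties.CommutativeMonoid.Sum +-0-commutativeMonoid
  using (sum-cong-≗; ∑-distrib-+; sum-replicate-zero) renaming (sum to ∑)
open import Data.Bool using (Bool; true; false; if_then_else_; _∨_)
open import Data.Bool.Properties using (∨-identityʳ; ¬-not) renaming (_≟_ to _≟ᵇ_)
open import Data.Empty using (⊥; ⊥-elim)
open import Data.Fin using (Fin; zero; suc)
open import Data.Fin.Properties using (_≟_; injective⇒≤) renaming (any? to anyFin?)
open import Data.List using (List; []; _∷_; _++_; length; lookup; tabulate)
open import Data.List.Properties using (map-tabulate)
open import Data.List.Membership.Propositional using (_∈_)
open import Data.List.Membership.Propositional.Properties using (∈-lookup)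
open import Data.List.Relation.Binary.Infix.Heterogeneous using (Infix; here; MkView; toView; _++ⁱ_)
open import Data.List.Relation.Binary.Infix.Heterogeneous.Properties using (infix?)
open import Data.List.Relation.Binary.Pointwise using ([]; _∷_)
open import Data.List.Relation.Binary.Prefix.Heterogeneous using ([]; _∷_)
import Data.List.Relation.Unary.All as All
open import Data.List.Relation.Unary.All using ([]; _∷_)
open import Data.List.Relation.Unary.All.Properties using (¬Any⇒All¬)
open import Data.List.Relation.Unary.AllPairs using ([]; _∷_)
open import Data.List.Relation.Unary.Any using (here; there; any?)
open import Data.List.Relation.Unary.Unique.Propositional using (Unique)
open import Data.Nat using (ℕ; zero; suc; _+_; _≤_; z≤n; s≤s; _≤?_)
import Data.Nat.ListAction as List
import Data.Product as Product
open import Data.Product using (∃; ∃₂; _×_; _,_; proj₁; proj₂)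
open import Data.Sum using (_⊎_; inj₁; inj₂; swap; [_,_])
open import Data.Unit using (tt)
open import Function using (_∘_; id)
open import Function.Bundles using (mk⇔)
open import Level using (0ℓ)
open import Relation.Binary.Core using (Rel; _⇒_)
open import Relation.Binary.Definitions using (Decidable; Symmetric)
open import Relation.Binary.PropositionalEquality
  using (_≡_; _≢_; ≢-sym; _≗_; refl; cong; sym; trans; module ≡-Reasoning)
open import Relation.Nullary using (¬_; Dec; yes; no; does)
open import Relation.Nullary.Decidable
  using (map′; _×-dec_; _⊎-dec_; ¬?; decidable-stable; does-⇔; dec-false; dec-true)
open import Relation.Nullary.Negation using (contradiction)

private
  variable
    n k m : ℕ

module _ {n : ℕ} where

  private
    variable
      R S : Rel (Fin n) 0ℓ
      u v w x y z : Fin n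

  vertices : Walk R u v k → List (Fin n)
  vertices nil                 = []
  vertices (cons {w = t} _ p) = t ∷ vertices p

  Path : Rel (Fin n) 0ℓ → Fin n → Fin n → Set
  Path R u v = ∃₂ λ k (p : Walk R u v k) → Unique (u ∷ vertices p)

  _▷_ : Walk R u v k → R v w → Walk R u w (suc k)
  nil      ▷ r = cons r nil
  cons s p ▷ r = cons s (p ▷ r)

  _++ʷ_ : Walk R u v k → Walk R v w m → Walk R u w (k + m)
  nil      ++ʷ q = q
  cons r p ++ʷ q = cons r (p ++ʷ q)

  reverse : Symmetric R → Walk R u v k → Walk R v u k
  reverse sym nil        = nil
  reverse sym (cons r p) = reverse sym p ▷ sym r

  map : R ⇒ S → Walk R u v k → Walk S u v k
  map f nil        = nil
  map f (cons r p) = cons (f r) (map f p)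

  walk-preserves : {P : Fin n → Set} → (∀ {x y} → P x → R x y → P y) →
                   Walk R u v k → P u → P v
  walk-preserves step nil        pu = pu
  walk-preserves step (cons r p) pu = walk-preserves step p (step pu r)

  suffix : (p : Walk R w v k) → Unique (w ∷ vertices p) → u ∈ w ∷ vertices p → Path R u v
  suffix p          p!       (here refl) = _ , p , p!
  suffix (cons _ p) (_ ∷ p!) (there u∈)  = suffix p p! u∈

  walk⇒path : Walk R u v k → Path R u v
  walk⇒path nil = _ , nil , [] ∷ []
  walk⇒path {u = u} (cons r p) with walk⇒path p
  ... | _ , q , q! with any? (u ≟_) (_ ∷ vertices q)
  ...   | yes u∈ = suffix q q! u∈
  ...   | no  u∉ = _ , cons r q , ¬Any⇒All¬ _ u∉ ∷ q!

  chain-map : R ⇒ S → ∀ l → Chain R l → Chain S l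
  chain-map f []          _       = tt
  chain-map f (_ ∷ [])    _       = tt
  chain-map f (_ ∷ _ ∷ l) (r , c) = f r , chain-map f (_ ∷ l) c

  chain-closed : R ⇒ S → (p : Walk R x y k) → S y z → Chain S (x ∷ vertices p ++ z ∷ [])
  chain-closed f nil        s = s , tt
  chain-closed f (cons r p) s = f r , chain-closed f p s

  consec-closed : (p : Walk R x y k) → Consec y z (x ∷ vertices p ++ z ∷ [])
  consec-closed nil = [] , [] , refl
  consec-closed {x = x} {z = z} (cons _ p) with consec-closed {z = z} p
  ... | as , bs , eq = x ∷ as , bs , cong (x ∷_) eq

  chain? : Decidable R → ∀ l → Dec (Chain R l)
  chain? R? []          = yes tt
  chain? R? (_ ∷ [])    = yes tt
  chain? R? (x ∷ y ∷ l) = R? x y ×-dec chain? R? (y ∷ l)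

  walk? : Decidable R → ∀ k → Decidable (λ u v → Walk R u v k)
  walk? R? zero    u v = map′ (λ { refl → nil }) (λ { nil → refl }) (u ≟ v)
  walk? R? (suc k) u v =
    map′ (λ (w , r , p) → cons r p) (λ { (cons r p) → _ , r , p })
         (anyFin? λ w → R? u w ×-dec walk? R? k w v)

  distLE? : Decidable R → ∀ d → Decidable (λ u v → DistLE R u v d)
  distLE? R? d u v =
    map′ (λ (k , k<1+d , p) → k , ≤-pred k<1+d , p) (λ (k , k≤d , p) → k , s≤s k≤d , p)
         (anyUpTo? (λ k → walk? R? k u v) (suc d))

module _ {n : ℕ} {R : Rel (Fin n) 0ℓ} (sym : Symmetric R) (R? : Decidable R)
         (acyclic : ∀ cs → ¬ Cycle R cs)
         (diameter≤3 : ∀ {a b} → Reach R a b → DistLE R a b 3) where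

  private
    through : ∀ {c a b} → Reach R c a → Reach R c b → Reach R a b
    through (k , p) (m , q) = k + m , reverse sym p ++ʷ q

    reach : ∀ {c a d} → DistLE R c a d → Reach R c a
    reach (k , _ , p) = k , p

  comp-star⊎doubleStar : ∀ c → CompIsStar R c ⊎ CompIsDoubleStar R c
  comp-star⊎doubleStar c with anyFin? (λ a → anyFin? (λ b →
    distLE? R? 3 c a ×-dec distLE? R? 3 c b ×-dec ¬? (distLE? R? 2 a b)))
  ... | yes (a , b , ca , cb , far) =
    inj₂ ((λ cs _ → acyclic cs) , (λ a b ca cb → diameter≤3 (through ca cb)) ,
          a , b , reach ca , reach cb , far)
  ... | no ∄far = inj₁ ((λ cs _ → acyclic cs) , λ a b ca cb →
    decidable-stable (distLE? R? 2 a b) λ far →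
      ∄far (a , b , diameter≤3 ca , diameter≤3 cb , far))

module _ {n : ℕ} where

  open import Data.List.Relation.Unary.Unique.DecPropositional (_≟_ {n}) using (unique?)

  private
    variable
      u v x y : Fin n

  SameEdge : Fin n → Fin n → Rel (Fin n) 0ℓ
  SameEdge u v x y = (x ≡ u × y ≡ v) ⊎ (x ≡ v × y ≡ u)

  sameEdge? : (u v : Fin n) → Decidable (SameEdge u v)
  sameEdge? u v x y = (x ≟ u ×-dec y ≟ v) ⊎-dec (x ≟ v ×-dec y ≟ u)

  ¬SameEdge-src : x ≢ u → x ≢ v → ¬ SameEdge u v x y
  ¬SameEdge-src x≢u x≢v = [ x≢u ∘ proj₁ , x≢v ∘ proj₁ ]

  ¬SameEdge-tgt : y ≢ u → y ≢ v → ¬ SameEdge u v x y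
  ¬SameEdge-tgt y≢u y≢v = [ y≢v ∘ proj₂ , y≢u ∘ proj₂ ]

  EdgeWithout : Graph n → Fin n → Fin n → Rel (Fin n) 0ℓ
  EdgeWithout G u v x y = Edge G x y × ¬ SameEdge u v x y

  Edge-sym : (G : Graph n) → Symmetric (Edge G)
  Edge-sym G {x} {y} xy = trans (Graph.sym G y x) xy

  Edge? : (G : Graph n) → Decidable (Edge G)
  Edge? G x y = adj G x y ≟ᵇ true

  onCycle-sym : (G : Graph n) → OnCycle G u v → OnCycle G v u
  onCycle-sym _ (cs , cyc , uv) = cs , cyc , swap uv

  cycle⇒onCycle : (G : Graph n) → ∀ cs → Cycle (Edge G) (x ∷ y ∷ cs) → OnCycle G x y
  cycle⇒onCycle _ _ cyc = _ , cyc , inj₁ ([] , _ , refl)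

  detour⇒onCycle : (G : Graph n) → Edge G u v → Walk (EdgeWithout G u v) v u k → OnCycle G u v
  detour⇒onCycle {u = u} G uv p with walk⇒path p
  ... | _ , nil , _                = contradiction (trans (sym uv) (Graph.irrefl G u)) λ ()
  ... | _ , cons (_ , ¬vu) nil , _ = contradiction (inj₂ (refl , refl)) ¬vu
  ... | _ , q@(cons _ (cons _ _)) , q! =
    _ , (s≤s (s≤s (s≤s z≤n)) , q! , chain-closed proj₁ q uv) , inj₁ (consec-closed q)

  DeleteCycleEdges-sym : (G : Graph n) → Symmetric (DeleteCycleEdges G)
  DeleteCycleEdges-sym G (xy , ¬cyc) = Edge-sym G xy , ¬cyc ∘ onCycle-sym G

  DeleteCycleEdges-acyclic : (G : Graph n) → ∀ cs → ¬ Cycle (DeleteCycleEdges G) cs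
  DeleteCycleEdges-acyclic G (_ ∷ []) (s≤s () , _)
  DeleteCycleEdges-acyclic G (x ∷ y ∷ l) (len , cs! , ((xy , ¬cyc) , c)) =
    ¬cyc (cycle⇒onCycle G l (len , cs! , chain-map proj₁ (x ∷ y ∷ l ++ x ∷ []) ((xy , ¬cyc) , c)))

  unique-length≤ : {xs : List (Fin n)} → Unique xs → length xs ≤ n
  unique-length≤ xs! = injective⇒≤ (lookup-injective xs!)
    where
    lookup-injective : {xs : List (Fin n)} → Unique xs →
                       ∀ {i j} → lookup xs i ≡ lookup xs j → i ≡ j
    lookup-injective (_ ∷ _)   {zero}  {zero}  _  = refl
    lookup-injective (x∉ ∷ _)  {zero}  {suc j} eq = contradiction eq (All.lookup x∉ (∈-lookup j))
    lookup-injective (x∉ ∷ _)  {suc i} {zero}  eq = contradiction (sym eq) (All.lookup x∉ (∈-lookup i))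
    lookup-injective (_ ∷ xs!) {suc i} {suc j} eq = cong suc (lookup-injective xs! eq)

  bounded-list? : ∀ k {P : List (Fin n) → Set} → (∀ xs → Dec (P xs)) →
                  Dec (∃ λ xs → length xs ≤ k × P xs)
  bounded-list? k P? with P? []
  ... | yes p = yes ([] , z≤n , p)
  bounded-list? zero    P? | no ¬p = no λ { ([] , _ , p) → ¬p p }
  bounded-list? (suc k) P? | no ¬p =
    map′ (λ (x , xs , len , p) → x ∷ xs , s≤s len , p)
         (λ { ([] , _ , p) → contradiction p ¬p ; (x ∷ xs , s≤s len , p) → x , xs , len , p })
         (anyFin? (λ x → bounded-list? k (λ xs → P? (x ∷ xs))))

  consec? : (u v : Fin n) (l : List (Fin n)) → Dec (Consec u v l)
  consec? u v l = map′ from to (infix? _≟_ (u ∷ v ∷ []) l)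
    where
    from : Infix _≡_ (u ∷ v ∷ []) l → Consec u v l
    from i with toView i
    ... | MkView as (refl ∷ refl ∷ []) bs = as , bs , refl
    to : Consec u v l → Infix _≡_ (u ∷ v ∷ []) l
    to (as , bs , refl) = as ++ⁱ here (refl ∷ refl ∷ [])

  cycle? : (G : Graph n) → ∀ cs → Dec (Cycle (Edge G) cs)
  cycle? G cs = 3 ≤? length cs ×-dec unique? cs ×-dec chain? (Edge? G) (closeUp cs)

  onCycle? : (G : Graph n) → Decidable (OnCycle G)
  onCycle? G u v =
    map′ (λ (cs , _ , c) → cs , c) (λ (cs , c) → cs , unique-length≤ (proj₁ (proj₂ (proj₁ c))) , c)
         (bounded-list? n λ cs →
           cycle? G cs ×-dec (consec? u v (closeUp cs) ⊎-dec consec? v u (closeUp cs)))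

  DeleteCycleEdges? : (G : Graph n) → Decidable (DeleteCycleEdges G)
  DeleteCycleEdges? G x y = Edge? G x y ×-dec ¬? (onCycle? G x y)

indicator : Bool → ℕ
indicator b = if b then 1 else 0

count : (Fin n → Bool) → ℕ
count r = ∑ (λ j → indicator (r j))

count-cong : {r r′ : Fin n → Bool} → r ≗ r′ → count r ≡ count r′
count-cong eq = sum-cong-≗ (cong indicator ∘ eq)

degree≡count : (G : Graph n) (i : Fin n) → degree G i ≡ count (adj G i)
degree≡count G i =
  trans (cong List.sum (map-tabulate id (indicator ∘ adj G i))) (sum-tabulate (indicator ∘ adj G i))
  where
  sum-tabulate : ∀ {m} (f : Fin m → ℕ) → List.sum (tabulate f) ≡ ∑ f
  sum-tabulate {zero}  f = refl
  sum-tabulate {suc m} f = cong (f zero +_) (sum-tabulate (f ∘ suc))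

point : Fin n → Fin n → Bool
point p j = does (j ≟ p)

count-point : (p : Fin n) → count (point p) ≡ 1
count-point {suc n} zero = cong suc (sum-replicate-zero n)
count-point (suc p)      = count-point p

move : Fin n → Fin n → (Fin n → Bool) → Fin n → Bool
move p q r j = if point p j then false else if point q j then true else r j

count-move : (r : Fin n → Bool) {p q : Fin n} → r p ≡ true → r q ≡ false →
             count (move p q r) ≡ count r
count-move r {p} {q} rp rq = suc-injective (begin
  1 + count (move p q r)                                      ≡⟨ cong (_+ count (move p q r)) (count-point p) ⟨
  count (point p) + count (move p q r)                        ≡⟨ ∑-distrib-+ (indicator ∘ point p) (indicator ∘ move p q r) ⟨
  ∑ (λ j → indicator (point p j) + indicator (move p q r j))  ≡⟨ sum-cong-≗ exchange ⟩
  ∑ (λ j → indicator (point q j) + indicator (r j))           ≡⟨ ∑-distrib-+ (indicator ∘ point q) (indicator ∘ r) ⟩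
  count (point q) + count r                                   ≡⟨ cong (_+ count r) (count-point q) ⟩
  1 + count r                                                 ∎)
  where
  open ≡-Reasoning
  exchange : ∀ j → indicator (point p j) + indicator (move p q r j)
                 ≡ indicator (point q j) + indicator (r j)
  exchange j with j ≟ p | j ≟ q
  ... | yes refl | yes refl = contradiction (trans (sym rp) rq) λ ()
  ... | yes refl | no _     rewrite rp = refl
  ... | no _     | yes refl rewrite rq = refl
  ... | no _     | no _     = refl

module _ {n : ℕ} where

  private
    variable
      u v x y : Fin n

  link : Fin n → Fin n → Fin n → Fin n → Bool
  link u v x y = does (sameEdge? u v x y)

  link-sym : link u v x y ≡ link u v y x
  link-sym {u = u} {v} {x} {y} = does-⇔ (mk⇔ turn turn) (sameEdge? u v x y) (sameEdge? u v y x)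
    where
    turn : ∀ {x y} → SameEdge u v x y → SameEdge u v y x
    turn = [ inj₂ ∘ Product.swap , inj₁ ∘ Product.swap ]

  link-diag : u ≢ v → link u v x x ≡ false
  link-diag {u = u} {v} {x} u≢v = dec-false (sameEdge? u v x x)
    λ { (inj₁ (refl , refl)) → u≢v refl ; (inj₂ (refl , refl)) → u≢v refl }

  link-src : u ≢ v → link u v u y ≡ point v y
  link-src {u = u} {v} {y} u≢v =
    does-⇔ (mk⇔ to (λ y≡v → inj₁ (refl , y≡v))) (sameEdge? u v u y) (y ≟ v)
    where
    to : SameEdge u v u y → y ≡ v
    to (inj₁ (_ , y≡v)) = y≡v
    to (inj₂ (u≡v , _)) = contradiction u≡v u≢v

  link-tgt : u ≢ v → link u v v y ≡ point u y
  link-tgt {u = u} {v} {y} u≢v =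
    does-⇔ (mk⇔ to (λ y≡u → inj₂ (refl , y≡u))) (sameEdge? u v v y) (y ≟ u)
    where
    to : SameEdge u v v y → y ≡ u
    to (inj₁ (v≡u , _)) = contradiction (sym v≡u) u≢v
    to (inj₂ (_ , y≡u)) = y≡u

  link-off : x ≢ u → x ≢ v → link u v x y ≡ false
  link-off {x = x} {u} {v} {y} x≢u x≢v = dec-false (sameEdge? u v x y) (¬SameEdge-src x≢u x≢v)

  link-false⇒¬SameEdge : link u v x y ≡ false → ¬ SameEdge u v x y
  link-false⇒¬SameEdge {u = u} {v} {x} {y} eq p =
    contradiction (trans (sym (dec-true (sameEdge? u v x y) p)) eq) λ ()

  link⇒SameEdge : link u v x y ≡ true → SameEdge u v x y
  link⇒SameEdge {u = u} {v} {x} {y} = witness (sameEdge? u v x y)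
    where
    witness : (d : Dec (SameEdge u v x y)) → does d ≡ true → SameEdge u v x y
    witness (yes p) _ = p

module TwoSwitch {n : ℕ} (G : Graph n) {a b d e : Fin n}
  (a≢b : a ≢ b) (a≢d : a ≢ d) (a≢e : a ≢ e) (b≢d : b ≢ d) (b≢e : b ≢ e) (d≢e : d ≢ e) where

  removed added : Fin n → Fin n → Bool
  removed i j = link a b i j ∨ link d e i j
  added   i j = link a e i j ∨ link b d i j

  switchedAdj : Fin n → Fin n → Bool
  switchedAdj i j = if removed i j then false else if added i j then true else adj G i j

  switchedAdj-sym : ∀ i j → switchedAdj i j ≡ switchedAdj j i
  switchedAdj-sym i j rewrite link-sym {u = a} {b} {i} {j} | link-sym {u = d} {e} {i} {j}
                            | link-sym {u = a} {e} {i} {j} | link-sym {u = b} {d} {i} {j}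
                            | Graph.sym G i j = refl

  switchedAdj-irrefl : ∀ i → switchedAdj i i ≡ false
  switchedAdj-irrefl i rewrite link-diag {x = i} a≢b | link-diag {x = i} d≢e
                             | link-diag {x = i} a≢e | link-diag {x = i} b≢d = Graph.irrefl G i

  switched : Graph n
  switched = record { adj = switchedAdj ; sym = switchedAdj-sym ; irrefl = switchedAdj-irrefl }

  private
    switched-cases : ∀ {r₁ r₂ a₁ a₂ g : Bool} →
                     (if r₁ ∨ r₂ then false else if a₁ ∨ a₂ then true else g) ≡ true →
                     (r₁ ≡ false × r₂ ≡ false × g ≡ true) ⊎ a₁ ≡ true ⊎ a₂ ≡ true
    switched-cases {false} {false} {true}          _  = inj₂ (inj₁ refl)
    switched-cases {false} {false} {false} {true}  _  = inj₂ (inj₂ refl)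
    switched-cases {false} {false} {false} {false} xy = inj₁ (refl , refl , xy)

  switched-edge : ∀ {x y} → Edge switched x y →
                  (EdgeWithout G a b x y × ¬ SameEdge d e x y) ⊎ SameEdge a e x y ⊎ SameEdge b d x y
  switched-edge {x} {y} xy with switched-cases {link a b x y} {link d e x y} xy
  ... | inj₁ (ab , de , xy′) = inj₁ ((xy′ , link-false⇒¬SameEdge ab) , link-false⇒¬SameEdge de)
  ... | inj₂ (inj₁ ae)       = inj₂ (inj₁ (link⇒SameEdge ae))
  ... | inj₂ (inj₂ bd)       = inj₂ (inj₂ (link⇒SameEdge bd))

  private
    row-a : ∀ j → switchedAdj a j ≡ move b e (adj G a) j
    row-a j rewrite link-src {y = j} a≢b | link-off {y = j} a≢d a≢e
                  | link-src {y = j} a≢e | link-off {y = j} a≢b a≢d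
                  | ∨-identityʳ (point b j) | ∨-identityʳ (point e j) = refl

    row-b : ∀ j → switchedAdj b j ≡ move a d (adj G b) j
    row-b j rewrite link-tgt {y = j} a≢b | link-off {y = j} b≢d b≢e
                  | link-off {y = j} (≢-sym a≢b) b≢e | link-src {y = j} b≢d
                  | ∨-identityʳ (point a j) = refl

    row-d : ∀ j → switchedAdj d j ≡ move e b (adj G d) j
    row-d j rewrite link-off {y = j} (≢-sym a≢d) (≢-sym b≢d) | link-src {y = j} d≢e
                  | link-off {y = j} (≢-sym a≢d) d≢e | link-tgt {y = j} b≢d = refl

    row-e : ∀ j → switchedAdj e j ≡ move d a (adj G e) j
    row-e j rewrite link-off {y = j} (≢-sym a≢e) (≢-sym b≢e) | link-tgt {y = j} d≢e
                  | link-tgt {y = j} a≢e | link-off {y = j} (≢-sym b≢e) (≢-sym d≢e)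
                  | ∨-identityʳ (point a j) = refl

    row-other : ∀ {i} → i ≢ a → i ≢ b → i ≢ d → i ≢ e → ∀ j → switchedAdj i j ≡ adj G i j
    row-other i≢a i≢b i≢d i≢e j
      rewrite link-off {y = j} i≢a i≢b | link-off {y = j} i≢d i≢e
            | link-off {y = j} i≢a i≢e | link-off {y = j} i≢b i≢d = refl

  degree-switched : Edge G a b → Edge G d e → adj G a e ≡ false → adj G b d ≡ false →
                    ∀ i → degree switched i ≡ degree G i
  degree-switched ab de ¬ae ¬bd i = begin
    degree switched i      ≡⟨ degree≡count switched i ⟩
    count (switchedAdj i)  ≡⟨ by-vertex (i ≟ a) (i ≟ b) (i ≟ d) (i ≟ e) ⟩
    count (adj G i)        ≡⟨ degree≡count G i ⟨
    degree G i             ∎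
    where
    open ≡-Reasoning
    ¬db : adj G d b ≡ false
    ¬db = trans (Graph.sym G d b) ¬bd
    ¬ea : adj G e a ≡ false
    ¬ea = trans (Graph.sym G e a) ¬ae
    by-vertex : ∀ {i} → Dec (i ≡ a) → Dec (i ≡ b) → Dec (i ≡ d) → Dec (i ≡ e) →
                count (switchedAdj i) ≡ count (adj G i)
    by-vertex (yes refl) _ _ _ = trans (count-cong row-a) (count-move (adj G a) ab ¬ae)
    by-vertex (no _) (yes refl) _ _ =
      trans (count-cong row-b) (count-move (adj G b) (Edge-sym G ab) ¬bd)
    by-vertex (no _) (no _) (yes refl) _ = trans (count-cong row-d) (count-move (adj G d) de ¬db)
    by-vertex (no _) (no _) (no _) (yes refl) =
      trans (count-cong row-e) (count-move (adj G e) (Edge-sym G de) ¬ea)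
    by-vertex (no i≢a) (no i≢b) (no i≢d) (no i≢e) = count-cong (row-other i≢a i≢b i≢d i≢e)

module Switching {n : ℕ} {G : Graph n} {a b c d e : Fin n}
  (a≢b : a ≢ b) (a≢c : a ≢ c) (a≢d : a ≢ d) (a≢e : a ≢ e) (b≢c : b ≢ c)
  (b≢d : b ≢ d) (b≢e : b ≢ e) (c≢d : c ≢ d) (c≢e : c ≢ e) (d≢e : d ≢ e)
  (ab : DeleteCycleEdges G a b) (bc : DeleteCycleEdges G b c)
  (cd : DeleteCycleEdges G c d) (de : DeleteCycleEdges G d e) where

  open TwoSwitch G a≢b a≢d a≢e b≢d b≢e d≢e public

  ¬bd : adj G b d ≡ false
  ¬bd = ¬-not λ bd → proj₂ bc (cycle⇒onCycle G (d ∷ [])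
    (s≤s (s≤s (s≤s z≤n)) , ((b≢c ∷ b≢d ∷ []) ∷ (c≢d ∷ []) ∷ [] ∷ []) ,
     proj₁ bc , proj₁ cd , Edge-sym G bd , tt))

  ¬ae : adj G a e ≡ false
  ¬ae = ¬-not λ ae → proj₂ ab (cycle⇒onCycle G (c ∷ d ∷ e ∷ [])
    (s≤s (s≤s (s≤s z≤n)) ,
     ((a≢b ∷ a≢c ∷ a≢d ∷ a≢e ∷ []) ∷ (b≢c ∷ b≢d ∷ b≢e ∷ []) ∷ (c≢d ∷ c≢e ∷ []) ∷ (d≢e ∷ []) ∷ [] ∷ []) ,
     proj₁ ab , proj₁ bc , proj₁ cd , proj₁ de , Edge-sym G ae , tt))

  switched-degree : ∀ i → degree switched i ≡ degree G i
  switched-degree = degree-switched (proj₁ ab) (proj₁ de) ¬ae ¬bd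

  Kept : Rel (Fin n) 0ℓ
  Kept x y = EdgeWithout G a b x y × ¬ SameEdge d e x y

  Reached : Fin n → Set
  Reached = Reach Kept b

  a-unreached : ¬ Reached a
  a-unreached (_ , p) = proj₂ ab (detour⇒onCycle G (proj₁ ab) (map proj₁ p))

  e-unreached : ¬ Reached e
  e-unreached (_ , p) = proj₂ de (onCycle-sym G (detour⇒onCycle G (Edge-sym G (proj₁ de))
    (cons (Edge-sym G (proj₁ cd) , ¬SameEdge-tgt c≢e c≢d)
      (cons (Edge-sym G (proj₁ bc) , ¬SameEdge-src c≢e c≢d)
        (map (λ ((xy , _) , ¬de) → xy , ¬de ∘ swap) p)))))

  d-reached : Reached d
  d-reached = _ , cons ((proj₁ bc , ¬SameEdge-tgt (≢-sym a≢c) (≢-sym b≢c)) , ¬SameEdge-src b≢d b≢e)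
                    (cons ((proj₁ cd , ¬SameEdge-src (≢-sym a≢c) (≢-sym b≢c)) , ¬SameEdge-src c≢d c≢e)
                      nil)

  reached-closed : ∀ {x y} → Reached x → Edge switched x y → Reached y
  reached-closed (k , p) xy with switched-edge xy
  ... | inj₁ kept                          = suc k , p ▷ kept
  ... | inj₂ (inj₁ (inj₁ (refl , refl))) = contradiction (k , p) a-unreached
  ... | inj₂ (inj₁ (inj₂ (refl , refl))) = contradiction (k , p) e-unreached
  ... | inj₂ (inj₂ (inj₁ (refl , refl))) = d-reached
  ... | inj₂ (inj₂ (inj₂ (refl , refl))) = 0 , nil

  switched-disconnected : ¬ Connected switched
  switched-disconnected connected =
    a-unreached (walk-preserves reached-closed (proj₂ (connected b a)) (0 , nil))

ForciblyConnected : (Fin n → ℕ) → Set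
ForciblyConnected {n} D = ∀ (H : Graph n) → Realizes H D → Connected H

forciblyUnicyclic⇒forciblyConnected : {D : Fin n → ℕ} → ForciblyUnicyclic D → ForciblyConnected D
forciblyUnicyclic⇒forciblyConnected (_ , forced) H H-realizes = proj₁ (forced H H-realizes)

forciblyBicyclic⇒forciblyConnected : {D : Fin n → ℕ} → ForciblyBicyclic D → ForciblyConnected D
forciblyBicyclic⇒forciblyConnected (_ , forced) H H-realizes = proj₁ (forced H H-realizes)

module _ {n : ℕ} {D : Fin n → ℕ} (forcibly-connected : ForciblyConnected D)
         {G : Graph n} (G-realizes : Realizes G D) where

  DeleteCycleEdges-P₅-free : ∀ {a b c d e xs} → Unique (a ∷ b ∷ c ∷ d ∷ e ∷ xs) →
    DeleteCycleEdges G a b → DeleteCycleEdges G b c →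
    DeleteCycleEdges G c d → DeleteCycleEdges G d e → ⊥
  DeleteCycleEdges-P₅-free
    ((a≢b ∷ a≢c ∷ a≢d ∷ a≢e ∷ _) ∷ (b≢c ∷ b≢d ∷ b≢e ∷ _) ∷ (c≢d ∷ c≢e ∷ _) ∷ (d≢e ∷ _) ∷ _)
    ab bc cd de =
    switched-disconnected (forcibly-connected switched λ i → trans (switched-degree i) (G-realizes i))
    where open Switching {G = G} a≢b a≢c a≢d a≢e b≢c b≢d b≢e c≢d c≢e d≢e ab bc cd de

  DeleteCycleEdges-diameter≤3 : ∀ {a b} → Reach (DeleteCycleEdges G) a b →
                                DistLE (DeleteCycleEdges G) a b 3
  DeleteCycleEdges-diameter≤3 (_ , p) with walk⇒path p
  ... | _ , q@nil                            , _ = 0 , z≤n , q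
  ... | _ , q@(cons _ nil)                   , _ = 1 , s≤s z≤n , q
  ... | _ , q@(cons _ (cons _ nil))          , _ = 2 , s≤s (s≤s z≤n) , q
  ... | _ , q@(cons _ (cons _ (cons _ nil))) , _ = 3 , s≤s (s≤s (s≤s z≤n)) , q
  ... | _ , cons ab (cons bc (cons cd (cons de _))) , q! =
    ⊥-elim (DeleteCycleEdges-P₅-free q! ab bc cd de)

corollary2p2 : ∀ (n : ℕ) (D : Fin n → ℕ)
    → ForciblyUnicyclic D ⊎ ForciblyBicyclic D
    → ∀ (G : Graph n) → Realizes G D
    → ∀ (c : Fin n)
    → CompIsStar (DeleteCycleEdges G) c ⊎ CompIsDoubleStar (DeleteCycleEdges G) c
corollary2p2 n D forcibly G G-realizes =
  comp-star⊎doubleStar (DeleteCycleEdges-sym G) (DeleteCycleEdges? G) (DeleteCycleEdges-acyclic G)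
                       (DeleteCycleEdges-diameter≤3 forcibly-connected {G} G-realizes)
  where
  forcibly-connected : ForciblyConnected D
  forcibly-connected =
    [ forciblyUnicyclic⇒forciblyConnected , forciblyBicyclic⇒forciblyConnected ] forcibly
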